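{- Let $H$ be a finite abelian group with $\operatorname{rank}(H)=s$, and let $(H,\mathcal S,\mathcal W)$ be a tame decomposition configuration. Then there is a positive integer $n$ and a tame decomposition configuration $(G,\mathcal T,\mathcal Z)$ with $G=(\mathbb{Z}/n\mathbb{Z})^s$ that has $(H,\mathcal S,\mathcal W)$ as a quotient. In particular, if $(H,\mathcal S)$ is a tame ramification configuration, then there is a tame ramification configuration $(G,\mathcal T)$ with $G=(\mathbb{Z}/n\mathbb{Z})^s$ which has $(H,\mathcal S)$ as a quotient.
   Context: For a finite group $G$, $\operatorname{rank}(G)$ is the minimal number of elements of $G$ which together with all their conjugates generate $G$ (for abelian $G$, the minimal number of generators). A (minimal) tame ramification configuration is a pair $(G,\mathcal T)$ with $G$ a finite group of rank $s$ and $\mathcal T=\{T_1,\dots,T_s\}$ cyclic subgroups which together with their conjugates generate $G$. A (minimal) tame decomposition configuration is a triple $(G,\mathcal T,\mathcal Z)$ with $(G,\mathcal T)$ a tame ramification configuration and $\mathcal Z=\{Z_1,\dots,Z_s\}$ subgroups of $G$ with $T_i$ normal in $Z_i$ and $Z_i/T_i$ cyclic. A tame ramification configuration $(H,\mathcal S)$ is a quotient of $(G,\mathcal T)$ if $\operatorname{rank}(H)=\operatorname{rank}(G)$ and there is a surjective homomorphism $\pi:G\to H$ with $\pi(T_i)=S_i$ for all $i$; $(H,\mathcal S,\mathcal W)$ is a quotient of $(G,\mathcal T,\mathcal Z)$ if in addition $\pi(Z_i)=W_i$ for all $i$. -}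

module Defs where

open import Level using (Level; _⊔_; 0ℓ) renaming (suc to lsuc)
open import Data.Nat using (ℕ; _≤_)
open import Data.Integer as ℤ using (ℤ; +_; -[1+_]; _-_; -_)
import Data.Integer.Properties as ℤP
open import Data.Integer.Tactic.RingSolver using (solve-∀)
open import Data.Fin using (Fin)
open import Data.Product using (Σ; ∃; ∃-syntax; _×_; _,_)
open import Relation.Binary.PropositionalEquality using (_≡_; refl; cong; cong₂; sym; trans)
open import Algebra.Bundles using (Group; AbelianGroup; RawGroup)
open import Algebra.Morphism.Structures using (IsGroupHomomorphism)

-- The group (ℤ/nℤ)^s, modelled as (Fin s → ℤ) with pointwise
-- congruence modulo n as the equality.

_≡[mod_]_ : ℤ → ℕ → ℤ → Set
a ≡[mod n ] b = ∃[ k ] (a - b ≡ k ℤ.* (+ n))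

private
  l-refl : ∀ a → a - a ≡ + 0 ℤ.* a
  l-refl = solve-∀
  l-sym : ∀ a b k → a - b ≡ k → b - a ≡ - k
  l-sym a b k e = trans (h a b) (cong -_ e)
    where h : ∀ a b → b - a ≡ - (a - b)
          h = solve-∀
  h-trans : ∀ a b c → a - c ≡ (a - b) ℤ.+ (b - c)
  h-trans = solve-∀
  h-cong : ∀ a b c d → (a ℤ.+ c) - (b ℤ.+ d) ≡ (a - b) ℤ.+ (c - d)
  h-cong = solve-∀
  h-neg : ∀ a b → (- a) - (- b) ≡ - (a - b)
  h-neg = solve-∀
  h-negm : ∀ k n → - (k ℤ.* n) ≡ (- k) ℤ.* n
  h-negm = solve-∀
  h-addm : ∀ k l n → k ℤ.* n ℤ.+ l ℤ.* n ≡ (k ℤ.+ l) ℤ.* n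
  h-addm = solve-∀
  h-zero : ∀ a n → a - a ≡ + 0 ℤ.* n
  h-zero = solve-∀

module ZnPow (n s : ℕ) where
  Carrier : Set
  Carrier = Fin s → ℤ

  _≈_ : Carrier → Carrier → Set
  x ≈ y = ∀ i → x i ≡[mod n ] y i

  ≡⇒≈ : ∀ {x y} → (∀ i → x i ≡ y i) → x ≈ y
  ≡⇒≈ {x} {y} e i rewrite e i = + 0 , h-zero (y i) (+ n)

  _∙_ : Carrier → Carrier → Carrier
  (x ∙ y) i = x i ℤ.+ y i

  ε : Carrier
  ε i = + 0

  _⁻¹ : Carrier → Carrier
  (x ⁻¹) i = - x i

  abelianGroup : AbelianGroup 0ℓ 0ℓ
  abelianGroup = record
    { Carrier = Carrier ; _≈_ = _≈_ ; _∙_ = _∙_ ; ε = ε ; _⁻¹ = _⁻¹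
    ; isAbelianGroup = record
      { isGroup = record
        { isMonoid = record
          { isSemigroup = record
            { isMagma = record
              { isEquivalence = record
                { refl = λ {x} i → + 0 , h-zero (x i) (+ n)
                ; sym = λ {x} {y} p i → let (k , e) = p i in
                    - k , trans (l-sym (x i) (y i) _ e) (h-negm k (+ n))
                ; trans = λ {x} {y} {z} p q i →
                    let (k , e) = p i ; (l , f) = q i in
                    k ℤ.+ l , trans (h-trans (x i) (y i) (z i))
                                (trans (cong₂ ℤ._+_ e f) (h-addm k l (+ n)))
                }
              ; ∙-cong = λ {x} {y} {u} {v} p q i →
                  let (k , e) = p i ; (l , f) = q i in
                  k ℤ.+ l , trans (h-cong (x i) (y i) (u i) (v i))
                              (trans (cong₂ ℤ._+_ e f) (h-addm k l (+ n)))
              }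
            ; assoc = λ x y z → ≡⇒≈ λ i → ℤP.+-assoc (x i) (y i) (z i)
            }
          ; identity = (λ x → ≡⇒≈ λ i → ℤP.+-identityˡ (x i))
                     , (λ x → ≡⇒≈ λ i → ℤP.+-identityʳ (x i))
          }
        ; inverse = (λ x → ≡⇒≈ λ i → ℤP.+-inverseˡ (x i))
                  , (λ x → ≡⇒≈ λ i → ℤP.+-inverseʳ (x i))
        ; ⁻¹-cong = λ {x} {y} p i → let (k , e) = p i in
            - k , trans (h-neg (x i) (y i)) (trans (cong -_ e) (h-negm k (+ n)))
        }
      ; comm = λ x y → ≡⇒≈ λ i → ℤP.+-comm (x i) (y i)
      }
    }

ℤ/_ℤ^_ : ℕ → ℕ → AbelianGroup 0ℓ 0ℓ
ℤ/ n ℤ^ s = ZnPow.abelianGroup n s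

module GroupNotions {c ℓ : Level} (G : Group c ℓ) where
  open Group G

  powℕ : Carrier → ℕ → Carrier
  powℕ g ℕ.zero = ε
  powℕ g (ℕ.suc m) = g ∙ powℕ g m

  _^ᶻ_ : Carrier → ℤ → Carrier
  g ^ᶻ (+ m) = powℕ g m
  g ^ᶻ -[1+ m ] = (powℕ g (ℕ.suc m)) ⁻¹

  IsFinite : Set (c ⊔ ℓ)
  IsFinite = ∃[ m ] Σ (Fin m → Carrier) λ f → ∀ x → ∃[ i ] (f i ≈ x)

  data NormalClosure {p : Level} (P : Carrier → Set p) : Carrier → Set (c ⊔ ℓ ⊔ p) where
    conj   : ∀ {x} g → P x → NormalClosure P (g ∙ x ∙ g ⁻¹)
    unit   : NormalClosure P ε
    mul    : ∀ {x y} → NormalClosure P x → NormalClosure P y → NormalClosure P (x ∙ y)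
    inv    : ∀ {x} → NormalClosure P x → NormalClosure P (x ⁻¹)
    ≈-resp : ∀ {x y} → x ≈ y → NormalClosure P x → NormalClosure P y

  NormallyGenerates : {p : Level} → (Carrier → Set p) → Set (c ⊔ ℓ ⊔ p)
  NormallyGenerates P = ∀ x → NormalClosure P x

  NormallyGeneratedBy : ℕ → Set (c ⊔ ℓ)
  NormallyGeneratedBy k =
    Σ (Fin k → Carrier) λ g → NormallyGenerates (λ y → ∃[ i ] (y ≈ g i))

  HasRank : ℕ → Set (c ⊔ ℓ)
  HasRank s = NormallyGeneratedBy s × (∀ k → NormallyGeneratedBy k → s ≤ k)

  record Subgroup (p : Level) : Set (c ⊔ ℓ ⊔ lsuc p) where
    field
      mem    : Carrier → Set p
      resp   : ∀ {x y} → x ≈ y → mem x → mem y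
      ε-mem  : mem ε
      ∙-mem  : ∀ {x y} → mem x → mem y → mem (x ∙ y)
      ⁻¹-mem : ∀ {x} → mem x → mem (x ⁻¹)
  open Subgroup public

  _⊆_ : ∀ {p q} → Subgroup p → Subgroup q → Set (c ⊔ p ⊔ q)
  A ⊆ B = ∀ {x} → mem A x → mem B x

  IsCyclic : ∀ {p} → Subgroup p → Set (c ⊔ ℓ ⊔ p)
  IsCyclic A = ∃[ g ] (∀ x → (mem A x → ∃[ k ] (x ≈ g ^ᶻ k))
                           × (∃[ k ] (x ≈ g ^ᶻ k) → mem A x))

  IsNormalIn : ∀ {p q} → Subgroup p → Subgroup q → Set (c ⊔ p ⊔ q)
  IsNormalIn T Z = ∀ {z t} → mem Z z → mem T t → mem T (z ∙ t ∙ z ⁻¹)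

  -- Z / T is cyclic (for T normal in Z): some coset zT generates Z/T,
  -- i.e. every w ∈ Z lies in the coset (z^k) T for some k
  QuotientCyclic : ∀ {p q} → Subgroup p → Subgroup q → Set (c ⊔ p ⊔ q)
  QuotientCyclic T Z = ∃[ z ] (mem Z z × (∀ w → mem Z w → ∃[ k ] mem T ((z ^ᶻ k) ⁻¹ ∙ w)))

  -- minimal tame ramification configuration (G, T) with |T| = s
  record TameRamConfig (p : Level) (s : ℕ) : Set (c ⊔ ℓ ⊔ lsuc p) where
    field
      rank     : HasRank s
      T        : Fin s → Subgroup p
      T-cyclic : ∀ i → IsCyclic (T i)
      T-gen    : NormallyGenerates (λ y → ∃[ i ] mem (T i) y)

  record TameDecConfig (p : Level) (s : ℕ) : Set (c ⊔ ℓ ⊔ lsuc p) where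
    field
      ram        : TameRamConfig p s
    open TameRamConfig ram public
    field
      Z          : Fin s → Subgroup p
      T⊆Z        : ∀ i → T i ⊆ Z i
      T-normal   : ∀ i → IsNormalIn (T i) (Z i)
      Z/T-cyclic : ∀ i → QuotientCyclic (T i) (Z i)

module _ {c₁ ℓ₁ c₂ ℓ₂ : Level} (G : Group c₁ ℓ₁) (H : Group c₂ ℓ₂) where
  private
    module G = Group G
    module H = Group H
    module NG = GroupNotions G
    module NH = GroupNotions H

  record Epi : Set (c₁ ⊔ ℓ₁ ⊔ c₂ ⊔ ℓ₂) where
    field
      π          : G.Carrier → H.Carrier
      isHom      : IsGroupHomomorphism G.rawGroup H.rawGroup π
      surjective : ∀ y → ∃[ x ] (π x H.≈ y)

  ImageEq : ∀ {p q} → (G.Carrier → H.Carrier) → NG.Subgroup p → NH.Subgroup q → Set _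
  ImageEq π A B = ∀ y → (NH.mem B y → ∃[ x ] (NG.mem A x × π x H.≈ y))
                       × (∃[ x ] (NG.mem A x × π x H.≈ y) → NH.mem B y)

  -- (H, S) is a quotient of (G, T).  rank(H) = rank(G) = s holds since
  -- both configurations carry a proof of HasRank s.
  record RamQuotient {p q : Level} {s : ℕ}
         (CG : NG.TameRamConfig p s) (CH : NH.TameRamConfig q s)
         : Set (c₁ ⊔ ℓ₁ ⊔ c₂ ⊔ ℓ₂ ⊔ p ⊔ q) where
    field
      epi     : Epi
    open Epi epi public
    field
      T↦S : ∀ i → ImageEq π (NG.TameRamConfig.T CG i) (NH.TameRamConfig.T CH i)

  record DecQuotient {p q : Level} {s : ℕ}
         (CG : NG.TameDecConfig p s) (CH : NH.TameDecConfig q s)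
         : Set (c₁ ⊔ ℓ₁ ⊔ c₂ ⊔ ℓ₂ ⊔ p ⊔ q) where
    field
      ramQuotient : RamQuotient (NG.TameDecConfig.ram CG) (NH.TameDecConfig.ram CH)
    open RamQuotient ramQuotient public
    field
      Z↦W : ∀ i → ImageEq π (NG.TameDecConfig.Z CG i) (NH.TameDecConfig.Z CH i)

{-# OPTIONS --safe #-}
-- Let n = m! where m is the size of an enumeration of H, so that the order of every
-- element of H divides n, and pick generators tᵢ of the cyclic groups Sᵢ. Then x ↦ ∏ⱼ tⱼ^xⱼ
-- is a well-defined homomorphism π : (ℤ/nℤ)ˢ → H; it is onto because the Sᵢ normally
-- generate H, and it maps the cyclic group ⟨δᵢ⟩ generated by the i-th unit vector onto Sᵢ.
-- If wᵢ ∈ Wᵢ generates Wᵢ/Sᵢ and π(uᵢ) = wᵢ, then Wᵢ = Sᵢ⟨wᵢ⟩ is the image of ⟨δᵢ⟩⟨uᵢ⟩.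
-- Finally (ℤ/nℤ)ˢ has rank s: the δᵢ generate it, and k normal generators of it map onto
-- k normal generators of H. A ramification configuration is the decomposition
-- configuration with Wᵢ = Sᵢ.
module Submission where

open import Defs
open import Level using (Level; 0ℓ)
open import Data.Nat using (ℕ; NonZero)
open import Data.Product using (Σ; _×_)
open import Algebra.Bundles using (AbelianGroup)
open AbelianGroup using (group)
open GroupNotions using (IsFinite; TameDecConfig; TameRamConfig)

open import Algebra.Bundles using (Group)
open import Algebra.Morphism.Structures using (IsGroupHomomorphism)
open import Data.Fin as Fin using (Fin; toℕ)
import Data.Fin.Properties as Fin
open import Data.Integer as ℤ using (ℤ; +_; -[1+_])
import Data.Integer.Properties as ℤ
open import Data.Integer.Tactic.RingSolver using (solve-∀)
open import Data.Nat as ℕ using (zero; suc; _!)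
import Data.Nat.Properties as ℕ
open import Data.Nat.Divisibility using (_∣_; divides; ∣-trans; m≤n⇒m!∣n!)
open import Data.Product using (∃-syntax; _,_; proj₁; proj₂)
open import Data.Vec.Functional using (Vector; tail; removeAt; replicate)
open import Function using (_∘_)
open import Relation.Binary.PropositionalEquality as ≡ using (_≡_; _≢_)
open import Relation.Nullary using (yes; no; contradiction)

0<m≤n⇒m∣n! : ∀ {m n} → 0 ℕ.< m → m ℕ.≤ n → m ∣ n !
0<m≤n⇒m∣n! {suc m} _ m≤n =
  ∣-trans (divides (m !) (ℕ.*-comm (suc m) (m !))) (m≤n⇒m!∣n! m≤n)

module Powers {c ℓ} (A : AbelianGroup c ℓ) where
  open AbelianGroup A hiding (group)
  open GroupNotions (group A) using (powℕ; _^ᶻ_; Subgroup; mem; ε-mem; ∙-mem; ⁻¹-mem)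
  open import Algebra.Properties.AbelianGroup A
  open import Relation.Binary.Reasoning.Setoid setoid

  powℕ-congˡ : ∀ {g h} m → g ≈ h → powℕ g m ≈ powℕ h m
  powℕ-congˡ zero    g≈h = refl
  powℕ-congˡ (suc m) g≈h = ∙-cong g≈h (powℕ-congˡ m g≈h)

  ^ᶻ-congˡ : ∀ {g h} a → g ≈ h → g ^ᶻ a ≈ h ^ᶻ a
  ^ᶻ-congˡ (+ m)    g≈h = powℕ-congˡ m g≈h
  ^ᶻ-congˡ -[1+ m ] g≈h = ⁻¹-cong (powℕ-congˡ (suc m) g≈h)

  ^ᶻ-suc : ∀ g a → g ^ᶻ ℤ.suc a ≈ g ∙ g ^ᶻ a
  ^ᶻ-suc g (+ m)          = refl
  ^ᶻ-suc g -[1+ zero ]    = begin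
    ε                ≈⟨ inverseʳ g ⟨
    g ∙ g ⁻¹         ≈⟨ ∙-congˡ (⁻¹-cong (identityʳ g)) ⟨
    g ∙ (g ∙ ε) ⁻¹   ∎
  ^ᶻ-suc g -[1+ suc m ] = begin
    powℕ g (suc m) ⁻¹                 ≈⟨ \\-leftDividesˡ g _ ⟨
    g ∙ (g ⁻¹ ∙ powℕ g (suc m) ⁻¹)    ≈⟨ ∙-congˡ (⁻¹-∙-comm g _) ⟩
    g ∙ (g ∙ powℕ g (suc m)) ⁻¹       ∎

  ^ᶻ-pred : ∀ g a → g ^ᶻ ℤ.pred a ≈ g ⁻¹ ∙ g ^ᶻ a
  ^ᶻ-pred g (+ zero)    = begin
    (g ∙ ε) ⁻¹  ≈⟨ ⁻¹-cong (identityʳ g) ⟩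
    g ⁻¹        ≈⟨ identityʳ _ ⟨
    g ⁻¹ ∙ ε    ∎
  ^ᶻ-pred g (+ suc m)   = sym (\\-leftDividesʳ g _)
  ^ᶻ-pred g -[1+ m ]    = sym (⁻¹-∙-comm g _)

  ^ᶻ-homo-+ : ∀ g a b → g ^ᶻ (a ℤ.+ b) ≈ g ^ᶻ a ∙ g ^ᶻ b
  ^ᶻ-homo-+ g (+ zero)       b = begin
    g ^ᶻ (+ 0 ℤ.+ b)  ≡⟨ ≡.cong (g ^ᶻ_) (ℤ.+-identityˡ b) ⟩
    g ^ᶻ b            ≈⟨ identityˡ _ ⟨
    ε ∙ g ^ᶻ b        ∎
  ^ᶻ-homo-+ g (+ suc m)      b = begin
    g ^ᶻ (+ suc m ℤ.+ b)        ≡⟨ ≡.cong (g ^ᶻ_) (ℤ.suc-+ m b) ⟩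
    g ^ᶻ ℤ.suc (+ m ℤ.+ b)      ≈⟨ ^ᶻ-suc g (+ m ℤ.+ b) ⟩
    g ∙ g ^ᶻ (+ m ℤ.+ b)        ≈⟨ ∙-congˡ (^ᶻ-homo-+ g (+ m) b) ⟩
    g ∙ (powℕ g m ∙ g ^ᶻ b)     ≈⟨ assoc _ _ _ ⟨
    g ∙ powℕ g m ∙ g ^ᶻ b       ∎
  ^ᶻ-homo-+ g -[1+ zero ]    b = begin
    g ^ᶻ ℤ.pred b               ≈⟨ ^ᶻ-pred g b ⟩
    g ⁻¹ ∙ g ^ᶻ b               ≈⟨ ∙-congʳ (⁻¹-cong (identityʳ g)) ⟨
    (g ∙ ε) ⁻¹ ∙ g ^ᶻ b         ∎
  ^ᶻ-homo-+ g -[1+ suc m ]   b = begin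
    g ^ᶻ (-[1+ suc m ] ℤ.+ b)            ≡⟨ ≡.cong (g ^ᶻ_) (ℤ.pred-+ -[1+ m ] b) ⟩
    g ^ᶻ ℤ.pred (-[1+ m ] ℤ.+ b)         ≈⟨ ^ᶻ-pred g (-[1+ m ] ℤ.+ b) ⟩
    g ⁻¹ ∙ g ^ᶻ (-[1+ m ] ℤ.+ b)         ≈⟨ ∙-congˡ (^ᶻ-homo-+ g -[1+ m ] b) ⟩
    g ⁻¹ ∙ (powℕ g (suc m) ⁻¹ ∙ g ^ᶻ b)  ≈⟨ assoc _ _ _ ⟨
    g ⁻¹ ∙ powℕ g (suc m) ⁻¹ ∙ g ^ᶻ b    ≈⟨ ∙-congʳ (⁻¹-∙-comm g _) ⟩
    (g ∙ powℕ g (suc m)) ⁻¹ ∙ g ^ᶻ b     ∎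

  ^ᶻ-neg : ∀ g a → g ^ᶻ (ℤ.- a) ≈ (g ^ᶻ a) ⁻¹
  ^ᶻ-neg g a = inverseˡ-unique _ _ (begin
    g ^ᶻ (ℤ.- a) ∙ g ^ᶻ a  ≈⟨ ^ᶻ-homo-+ g (ℤ.- a) a ⟨
    g ^ᶻ (ℤ.- a ℤ.+ a)     ≡⟨ ≡.cong (g ^ᶻ_) (ℤ.+-inverseˡ a) ⟩
    ε                      ∎)

  ^ᶻ-multiple≈ε : ∀ {g} n → powℕ g n ≈ ε → ∀ k → g ^ᶻ (k ℤ.* + n) ≈ ε
  ^ᶻ-multiple≈ε {g} n gⁿ≈ε (+ k)    = nonNegative k
    where
    nonNegative : ∀ k → g ^ᶻ (+ k ℤ.* + n) ≈ ε
    nonNegative zero    = reflexive (≡.cong (g ^ᶻ_) (ℤ.*-zeroˡ (+ n)))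
    nonNegative (suc k) = begin
      g ^ᶻ (+ suc k ℤ.* + n)         ≡⟨ ≡.cong (g ^ᶻ_) (≡.sym (ℤ.pos-* (suc k) n)) ⟩
      g ^ᶻ (+ n ℤ.+ + (k ℕ.* n))     ≈⟨ ^ᶻ-homo-+ g (+ n) (+ (k ℕ.* n)) ⟩
      powℕ g n ∙ g ^ᶻ (+ (k ℕ.* n))  ≡⟨ ≡.cong (λ a → powℕ g n ∙ g ^ᶻ a) (ℤ.pos-* k n) ⟩
      powℕ g n ∙ g ^ᶻ (+ k ℤ.* + n)  ≈⟨ ∙-cong gⁿ≈ε (nonNegative k) ⟩
      ε ∙ ε                          ≈⟨ identityˡ ε ⟩
      ε                              ∎
  ^ᶻ-multiple≈ε {g} n gⁿ≈ε -[1+ k ] = begin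
    g ^ᶻ (-[1+ k ] ℤ.* + n)        ≡⟨ ≡.cong (g ^ᶻ_) (≡.sym (ℤ.neg-distribˡ-* (+ suc k) (+ n))) ⟩
    g ^ᶻ (ℤ.- (+ suc k ℤ.* + n))   ≈⟨ ^ᶻ-neg g (+ suc k ℤ.* + n) ⟩
    (g ^ᶻ (+ suc k ℤ.* + n)) ⁻¹    ≈⟨ ⁻¹-cong (^ᶻ-multiple≈ε n gⁿ≈ε (+ suc k)) ⟩
    ε ⁻¹                           ≈⟨ ε⁻¹≈ε ⟩
    ε                              ∎

  ^ᶻ-cong-mod : ∀ {g} n → powℕ g n ≈ ε → ∀ {a b} → a ≡[mod n ] b → g ^ᶻ a ≈ g ^ᶻ b
  ^ᶻ-cong-mod {g} n gⁿ≈ε {a} {b} (k , a-b≡kn) = begin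
    g ^ᶻ a                      ≡⟨ ≡.cong (g ^ᶻ_) a≡kn+b ⟩
    g ^ᶻ (k ℤ.* + n ℤ.+ b)      ≈⟨ ^ᶻ-homo-+ g (k ℤ.* + n) b ⟩
    g ^ᶻ (k ℤ.* + n) ∙ g ^ᶻ b   ≈⟨ ∙-congʳ (^ᶻ-multiple≈ε n gⁿ≈ε k) ⟩
    ε ∙ g ^ᶻ b                  ≈⟨ identityˡ _ ⟩
    g ^ᶻ b                      ∎
    where
    a≡a-b+b : ∀ a b → a ≡ a ℤ.- b ℤ.+ b
    a≡a-b+b = solve-∀
    a≡kn+b : a ≡ k ℤ.* + n ℤ.+ b
    a≡kn+b = ≡.trans (a≡a-b+b a b) (≡.cong (ℤ._+ b) a-b≡kn)

  ^ᶻ-mem : ∀ {p} (S : Subgroup p) {g} a → mem S g → mem S (g ^ᶻ a)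
  ^ᶻ-mem S (+ m)    g∈S = powℕ-mem m
    where
    powℕ-mem : ∀ m → mem S (powℕ _ m)
    powℕ-mem zero    = ε-mem S
    powℕ-mem (suc m) = ∙-mem S g∈S (powℕ-mem m)
  ^ᶻ-mem S -[1+ m ] g∈S = ⁻¹-mem S (^ᶻ-mem S (+ suc m) g∈S)

  powℕ-period : ∀ g {a b} → a ℕ.≤ b → powℕ g a ≈ powℕ g b → powℕ g (b ℕ.∸ a) ≈ ε
  powℕ-period g {a} {b} a≤b gᵃ≈gᵇ = identityˡ-unique (powℕ g (b ℕ.∸ a)) (powℕ g a) (begin
    powℕ g (b ℕ.∸ a) ∙ powℕ g a  ≈⟨ ^ᶻ-homo-+ g (+ (b ℕ.∸ a)) (+ a) ⟨
    powℕ g (b ℕ.∸ a ℕ.+ a)       ≡⟨ ≡.cong (powℕ g) (ℕ.m∸n+n≡m a≤b) ⟩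
    powℕ g b                     ≈⟨ gᵃ≈gᵇ ⟨
    powℕ g a                     ∎)

  -- Among g⁰, …, gᵐ two powers coincide, so g has an order d ≤ m, and d ∣ m!.
  powℕ-factorial≈ε : ((m , _) : IsFinite (group A)) → ∀ g → powℕ g (m !) ≈ ε
  powℕ-factorial≈ε (m , f , f-onto) g
    with i , j , i<j , fᵢ≡fⱼ ← Fin.pigeonhole (ℕ.n<1+n m) (λ k → proj₁ (f-onto (powℕ g (toℕ k))))
    with divides q m!≡qd ← 0<m≤n⇒m∣n! (ℕ.m<n⇒0<n∸m i<j)
                            (ℕ.≤-trans (ℕ.m∸n≤m (toℕ j) (toℕ i)) (ℕ.s≤s⁻¹ (Fin.toℕ<n j)))
    = begin
      powℕ g (m !)          ≡⟨ ≡.cong (powℕ g) m!≡qd ⟩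
      powℕ g (q ℕ.* d)      ≡⟨ ≡.cong (g ^ᶻ_) (ℤ.pos-* q d) ⟩
      g ^ᶻ (+ q ℤ.* + d)    ≈⟨ ^ᶻ-multiple≈ε d (powℕ-period g (ℕ.<⇒≤ i<j) gⁱ≈gʲ) (+ q) ⟩
      ε                     ∎
    where
    d = toℕ j ℕ.∸ toℕ i
    gⁱ≈gʲ : powℕ g (toℕ i) ≈ powℕ g (toℕ j)
    gⁱ≈gʲ = begin
      powℕ g (toℕ i)   ≈⟨ proj₂ (f-onto _) ⟨
      f _              ≡⟨ ≡.cong f fᵢ≡fⱼ ⟩
      f _              ≈⟨ proj₂ (f-onto _) ⟩
      powℕ g (toℕ j)   ∎

module FiniteProducts {c ℓ} (A : AbelianGroup c ℓ) where
  open AbelianGroup A hiding (group)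
  open import Algebra.Properties.AbelianGroup A using (ε⁻¹≈ε; ⁻¹-∙-comm)
  open import Algebra.Properties.CommutativeMonoid.Sum commutativeMonoid public
    using (sum; sum-cong-≋; ∑-distrib-+; sum-replicate-zero)
  open import Algebra.Properties.CommutativeMonoid.Sum commutativeMonoid
    using (sum-remove)
  open import Relation.Binary.Reasoning.Setoid setoid

  sum-⁻¹ : ∀ {k} (f : Vector Carrier k) → sum (λ i → f i ⁻¹) ≈ sum f ⁻¹
  sum-⁻¹ {zero}  f = sym ε⁻¹≈ε
  sum-⁻¹ {suc k} f = trans (∙-congˡ (sum-⁻¹ (tail f))) (⁻¹-∙-comm _ _)

  sum-single : ∀ {k} (f : Vector Carrier k) i → (∀ j → j ≢ i → f j ≈ ε) → sum f ≈ f i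
  sum-single {suc k} f i off = begin
    sum f                       ≈⟨ sum-remove f ⟩
    f i ∙ sum (removeAt f i)    ≈⟨ ∙-congˡ (sum-cong-≋ (λ j → off _ (Fin.punchInᵢ≢i i j))) ⟩
    f i ∙ sum (replicate k ε)   ≈⟨ ∙-congˡ (sum-replicate-zero k) ⟩
    f i ∙ ε                     ≈⟨ identityʳ (f i) ⟩
    f i                         ∎

module NormalClosureProperties {c ℓ} (G : Group c ℓ) where
  open Group G
  open GroupNotions G
  open import Algebra.Properties.Group G using (ε⁻¹≈ε)
  open import Algebra.Properties.Monoid.Sum monoid using (sum)
  open import Relation.Binary.Reasoning.Setoid setoid

  module _ {p} {P : Carrier → Set p} where

    NormalClosure-base : ∀ {y} → P y → NormalClosure P y
    NormalClosure-base {y} Py = ≈-resp εyε⁻¹≈y (conj ε Py)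
      where
      εyε⁻¹≈y : ε ∙ y ∙ ε ⁻¹ ≈ y
      εyε⁻¹≈y = begin
        ε ∙ y ∙ ε ⁻¹  ≈⟨ ∙-cong (identityˡ y) ε⁻¹≈ε ⟩
        y ∙ ε         ≈⟨ identityʳ y ⟩
        y             ∎

    NormalClosure-^ᶻ : ∀ {g} a → NormalClosure P g → NormalClosure P (g ^ᶻ a)
    NormalClosure-^ᶻ (+ a)    g∈⟪P⟫ = NormalClosure-powℕ a
      where
      NormalClosure-powℕ : ∀ a → NormalClosure P (powℕ _ a)
      NormalClosure-powℕ zero    = unit
      NormalClosure-powℕ (suc a) = mul g∈⟪P⟫ (NormalClosure-powℕ a)
    NormalClosure-^ᶻ -[1+ a ] g∈⟪P⟫ = inv (NormalClosure-^ᶻ (+ suc a) g∈⟪P⟫)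

    NormalClosure-sum : ∀ {k} (f : Vector Carrier k) →
                        (∀ i → NormalClosure P (f i)) → NormalClosure P (sum f)
    NormalClosure-sum {zero}  f f∈⟪P⟫ = unit
    NormalClosure-sum {suc k} f f∈⟪P⟫ =
      mul (f∈⟪P⟫ Fin.zero) (NormalClosure-sum (tail f) (f∈⟪P⟫ ∘ Fin.suc))

module HomomorphismProperties {c₁ ℓ₁ c₂ ℓ₂} (G : Group c₁ ℓ₁) (H : Group c₂ ℓ₂)
         {f : Group.Carrier G → Group.Carrier H}
         (f-hom : IsGroupHomomorphism (Group.rawGroup G) (Group.rawGroup H) f) where
  private
    module G = Group G
    module H = Group H
    module NG = GroupNotions G
    module NH = GroupNotions H
  open IsGroupHomomorphism f-hom

  homo-powℕ : ∀ g m → f (NG.powℕ g m) H.≈ NH.powℕ (f g) m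
  homo-powℕ g zero    = ε-homo
  homo-powℕ g (suc m) = H.trans (homo g _) (H.∙-congˡ (homo-powℕ g m))

  homo-^ᶻ : ∀ g a → f (g NG.^ᶻ a) H.≈ f g NH.^ᶻ a
  homo-^ᶻ g (+ m)    = homo-powℕ g m
  homo-^ᶻ g -[1+ m ] = H.trans (⁻¹-homo _) (H.⁻¹-cong (homo-powℕ g (suc m)))

  NormalClosure-map : ∀ {p q} {P : G.Carrier → Set p} {Q : H.Carrier → Set q} →
                      (∀ {x} → P x → Q (f x)) →
                      ∀ {x} → NG.NormalClosure P x → NH.NormalClosure Q (f x)
  NormalClosure-map P⇒Q (NG.conj {x} g Px)  = NH.≈-resp f-conj (NH.conj (f g) (P⇒Q Px))
    where
    f-conj : f g H.∙ f x H.∙ f g H.⁻¹ H.≈ f (g G.∙ x G.∙ g G.⁻¹)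
    f-conj = H.sym (H.trans (homo _ _) (H.∙-cong (homo g x) (⁻¹-homo g)))
  NormalClosure-map P⇒Q NG.unit              = NH.≈-resp (H.sym ε-homo) NH.unit
  NormalClosure-map P⇒Q (NG.mul {x} {y} a b) =
    NH.≈-resp (H.sym (homo x y)) (NH.mul (NormalClosure-map P⇒Q a) (NormalClosure-map P⇒Q b))
  NormalClosure-map P⇒Q (NG.inv {x} a)       =
    NH.≈-resp (H.sym (⁻¹-homo x)) (NH.inv (NormalClosure-map P⇒Q a))
  NormalClosure-map P⇒Q (NG.≈-resp x≈y a)    = NH.≈-resp (⟦⟧-cong x≈y) (NormalClosure-map P⇒Q a)

  NormallyGeneratedBy-surjection : (∀ y → ∃[ x ] (f x H.≈ y)) →
                                   ∀ {k} → NG.NormallyGeneratedBy k → NH.NormallyGeneratedBy k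
  NormallyGeneratedBy-surjection f-onto (g , gen) = (λ i → f (g i)) , λ y →
    let (x , fx≈y) = f-onto y
    in NH.≈-resp fx≈y (NormalClosure-map (λ (i , x≈gᵢ) → i , ⟦⟧-cong x≈gᵢ) (gen x))

  HasRank-surjection : (∀ y → ∃[ x ] (f x H.≈ y)) →
                       ∀ {s} → NH.HasRank s → NG.NormallyGeneratedBy s → NG.HasRank s
  HasRank-surjection f-onto (_ , minimal) gen =
    gen , λ k genₖ → minimal k (NormallyGeneratedBy-surjection f-onto genₖ)

module AbelianImage {c₁ ℓ₁ c₂ ℓ₂} (G : Group c₁ ℓ₁) (H : AbelianGroup c₂ ℓ₂)
         {f : Group.Carrier G → AbelianGroup.Carrier H}
         (f-hom : IsGroupHomomorphism (Group.rawGroup G) (Group.rawGroup (group H)) f) where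
  private
    module G = Group G
    module H = AbelianGroup H
    module NH = GroupNotions (group H)
  open IsGroupHomomorphism f-hom
  open import Algebra.Properties.AbelianGroup H using (xyx⁻¹≈y)

  NormalClosure⊆image : ∀ {p} {P : H.Carrier → Set p} → (∀ {y} → P y → ∃[ x ] (f x H.≈ y)) →
                        ∀ {y} → NH.NormalClosure P y → ∃[ x ] (f x H.≈ y)
  NormalClosure⊆image P⊆im (NH.conj g Py) =
    let (x , fx≈y) = P⊆im Py in x , H.trans fx≈y (H.sym (xyx⁻¹≈y g _))
  NormalClosure⊆image P⊆im NH.unit = G.ε , ε-homo
  NormalClosure⊆image P⊆im (NH.mul a b) =
    let (x , fx≈y) = NormalClosure⊆image P⊆im a ; (x′ , fx′≈y′) = NormalClosure⊆image P⊆im b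
    in x G.∙ x′ , H.trans (homo x x′) (H.∙-cong fx≈y fx′≈y′)
  NormalClosure⊆image P⊆im (NH.inv a) =
    let (x , fx≈y) = NormalClosure⊆image P⊆im a in x G.⁻¹ , H.trans (⁻¹-homo x) (H.⁻¹-cong fx≈y)
  NormalClosure⊆image P⊆im (NH.≈-resp y≈y′ a) =
    let (x , fx≈y) = NormalClosure⊆image P⊆im a in x , H.trans fx≈y y≈y′

module PowerSubgroups {c ℓ} (A : AbelianGroup c ℓ) where
  open AbelianGroup A hiding (group)
  open GroupNotions (group A)
  open Powers A using (^ᶻ-homo-+; ^ᶻ-neg; ^ᶻ-mem)
  open import Algebra.Properties.AbelianGroup A
    using (⁻¹-∙-comm; \\-leftDividesˡ; \\-leftDividesʳ; ε⁻¹≈ε; xyx⁻¹≈y)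
  open import Algebra.Properties.CommutativeSemigroup commutativeSemigroup using (interchange)
  open import Relation.Binary.Reasoning.Setoid setoid

  ⟨_⟩ : Carrier → Subgroup ℓ
  ⟨ g ⟩ = record
    { mem    = λ x → ∃[ k ] (x ≈ g ^ᶻ k)
    ; resp   = λ x≈y (k , x≈gᵏ) → k , trans (sym x≈y) x≈gᵏ
    ; ε-mem  = + 0 , refl
    ; ∙-mem  = λ (k , x≈gᵏ) (l , y≈gˡ) → k ℤ.+ l , trans (∙-cong x≈gᵏ y≈gˡ) (sym (^ᶻ-homo-+ g k l))
    ; ⁻¹-mem = λ (k , x≈gᵏ) → ℤ.- k , trans (⁻¹-cong x≈gᵏ) (sym (^ᶻ-neg g k))
    }

  ⟨_⟩⟨_⟩ : Carrier → Carrier → Subgroup ℓ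
  ⟨ g ⟩⟨ h ⟩ = record
    { mem    = λ x → ∃[ k ] ∃[ l ] (x ≈ g ^ᶻ k ∙ h ^ᶻ l)
    ; resp   = λ x≈y (k , l , x≈gᵏhˡ) → k , l , trans (sym x≈y) x≈gᵏhˡ
    ; ε-mem  = + 0 , + 0 , sym (identityˡ ε)
    ; ∙-mem  = λ {x} {y} (k , l , x≈gᵏhˡ) (k′ , l′ , y≈gᵏ′hˡ′) → k ℤ.+ k′ , l ℤ.+ l′ , (begin
        x ∙ y                                     ≈⟨ ∙-cong x≈gᵏhˡ y≈gᵏ′hˡ′ ⟩
        (g ^ᶻ k ∙ h ^ᶻ l) ∙ (g ^ᶻ k′ ∙ h ^ᶻ l′)   ≈⟨ interchange _ _ _ _ ⟩
        (g ^ᶻ k ∙ g ^ᶻ k′) ∙ (h ^ᶻ l ∙ h ^ᶻ l′)   ≈⟨ ∙-cong (^ᶻ-homo-+ g k k′) (^ᶻ-homo-+ h l l′) ⟨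
        g ^ᶻ (k ℤ.+ k′) ∙ h ^ᶻ (l ℤ.+ l′)         ∎)
    ; ⁻¹-mem = λ {x} (k , l , x≈gᵏhˡ) → ℤ.- k , ℤ.- l , (begin
        x ⁻¹                          ≈⟨ ⁻¹-cong x≈gᵏhˡ ⟩
        (g ^ᶻ k ∙ h ^ᶻ l) ⁻¹          ≈⟨ ⁻¹-∙-comm _ _ ⟨
        (g ^ᶻ k) ⁻¹ ∙ (h ^ᶻ l) ⁻¹     ≈⟨ ∙-cong (^ᶻ-neg g k) (^ᶻ-neg h l) ⟨
        g ^ᶻ (ℤ.- k) ∙ h ^ᶻ (ℤ.- l)   ∎)
    }

  ⟨⟩-isCyclic : ∀ g → IsCyclic ⟨ g ⟩
  ⟨⟩-isCyclic g = g , λ x → (λ x∈⟨g⟩ → x∈⟨g⟩) , (λ x∈⟨g⟩ → x∈⟨g⟩)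

  ⟨⟩⊆⟨⟩⟨⟩ : ∀ g h → ⟨ g ⟩ ⊆ ⟨ g ⟩⟨ h ⟩
  ⟨⟩⊆⟨⟩⟨⟩ g h (k , x≈gᵏ) = k , + 0 , trans x≈gᵏ (sym (identityʳ _))

  ⟨⟩⟨⟩/⟨⟩-cyclic : ∀ g h → QuotientCyclic ⟨ g ⟩ ⟨ g ⟩⟨ h ⟩
  ⟨⟩⟨⟩/⟨⟩-cyclic g h = h , (+ 0 , + 1 , sym (trans (identityˡ _) (identityʳ h))) ,
    λ x (k , l , x≈gᵏhˡ) → l , k , (begin
      (h ^ᶻ l) ⁻¹ ∙ x                   ≈⟨ ∙-congˡ (trans x≈gᵏhˡ (comm _ _)) ⟩
      (h ^ᶻ l) ⁻¹ ∙ (h ^ᶻ l ∙ g ^ᶻ k)   ≈⟨ \\-leftDividesʳ _ _ ⟩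
      g ^ᶻ k                            ∎)

  IsNormalIn-abelian : ∀ {p q} (T : Subgroup p) (Z : Subgroup q) → IsNormalIn T Z
  IsNormalIn-abelian T Z {z} {t} _ t∈T = resp T (sym (xyx⁻¹≈y z t)) t∈T

  QuotientCyclic-refl : ∀ {p} (T : Subgroup p) → QuotientCyclic T T
  QuotientCyclic-refl T = ε , ε-mem T , λ x x∈T →
    + 0 , resp T (sym (trans (∙-congʳ ε⁻¹≈ε) (identityˡ x))) x∈T

  ⟨⟩⟨⟩⊆QuotientCyclic : ∀ {p q} (T : Subgroup p) (Z : Subgroup q) t → ⟨ t ⟩ ⊆ T → T ⊆ Z →
                        ((w , _) : QuotientCyclic T Z) → ⟨ t ⟩⟨ w ⟩ ⊆ Z
  ⟨⟩⟨⟩⊆QuotientCyclic T Z t ⟨t⟩⊆T T⊆Z (w , w∈Z , _) (k , l , x≈tᵏwˡ) =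
    resp Z (sym x≈tᵏwˡ) (∙-mem Z (T⊆Z (⟨t⟩⊆T (k , refl))) (^ᶻ-mem Z l w∈Z))

  QuotientCyclic⊆⟨⟩⟨⟩ : ∀ {p q} (T : Subgroup p) (Z : Subgroup q) t → T ⊆ ⟨ t ⟩ →
                        ((w , _) : QuotientCyclic T Z) → Z ⊆ ⟨ t ⟩⟨ w ⟩
  QuotientCyclic⊆⟨⟩⟨⟩ T Z t T⊆⟨t⟩ (w , _ , Z/T-gen) {x} x∈Z =
    let (l , w⁻ˡx∈T) = Z/T-gen x x∈Z ; (k , w⁻ˡx≈tᵏ) = T⊆⟨t⟩ w⁻ˡx∈T
    in k , l , (begin
      x                            ≈⟨ \\-leftDividesˡ (w ^ᶻ l) x ⟨
      w ^ᶻ l ∙ ((w ^ᶻ l) ⁻¹ ∙ x)   ≈⟨ ∙-congˡ w⁻ˡx≈tᵏ ⟩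
      w ^ᶻ l ∙ t ^ᶻ k              ≈⟨ comm _ _ ⟩
      t ^ᶻ k ∙ w ^ᶻ l              ∎)

module PowerSubgroupImages {c₁ ℓ₁ c₂ ℓ₂} (A : AbelianGroup c₁ ℓ₁) (B : AbelianGroup c₂ ℓ₂)
         {f : AbelianGroup.Carrier A → AbelianGroup.Carrier B}
         (f-hom : IsGroupHomomorphism (Group.rawGroup (group A)) (Group.rawGroup (group B)) f) where
  private
    module A = AbelianGroup A
    module B = AbelianGroup B
    module NA = GroupNotions (group A)
    module NB = GroupNotions (group B)
  open IsGroupHomomorphism f-hom using (⟦⟧-cong; homo)
  open PowerSubgroups A using (⟨_⟩; ⟨_⟩⟨_⟩)
  open PowerSubgroups B using () renaming (⟨_⟩ to ⟨_⟩ᴮ; ⟨_⟩⟨_⟩ to ⟨_⟩⟨_⟩ᴮ)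
  open Powers B using (^ᶻ-congˡ)
  open HomomorphismProperties (group A) (group B) f-hom using (homo-^ᶻ)
  open import Relation.Binary.Reasoning.Setoid B.setoid

  ImageEq-resp : ∀ {p q q′} (U : NA.Subgroup p) (S : NB.Subgroup q) (S′ : NB.Subgroup q′) →
                 S NB.⊆ S′ → S′ NB.⊆ S →
                 ImageEq (group A) (group B) f U S → ImageEq (group A) (group B) f U S′
  ImageEq-resp U S S′ S⊆S′ S′⊆S f[U]≡S y = proj₁ (f[U]≡S y) ∘ S′⊆S , S⊆S′ ∘ proj₂ (f[U]≡S y)

  ImageEq-⟨⟩ : ∀ g {t} → f g B.≈ t → ImageEq (group A) (group B) f ⟨ g ⟩ ⟨ t ⟩ᴮ
  ImageEq-⟨⟩ g {t} fg≈t y =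
      (λ (k , y≈tᵏ) → g NA.^ᶻ k , (k , A.refl) , B.trans (f-gᵏ k) (B.sym y≈tᵏ))
    , (λ (x , (k , x≈gᵏ) , fx≈y) → k , B.trans (B.sym fx≈y) (B.trans (⟦⟧-cong x≈gᵏ) (f-gᵏ k)))
    where
    f-gᵏ : ∀ k → f (g NA.^ᶻ k) B.≈ t NB.^ᶻ k
    f-gᵏ k = B.trans (homo-^ᶻ g k) (^ᶻ-congˡ k fg≈t)

  ImageEq-⟨⟩⟨⟩ : ∀ g h {t w} → f g B.≈ t → f h B.≈ w →
                 ImageEq (group A) (group B) f ⟨ g ⟩⟨ h ⟩ ⟨ t ⟩⟨ w ⟩ᴮ
  ImageEq-⟨⟩⟨⟩ g h {t} {w} fg≈t fh≈w y =
      (λ (k , l , y≈tᵏwˡ) →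
        g NA.^ᶻ k A.∙ h NA.^ᶻ l , (k , l , A.refl) , B.trans (f-gᵏhˡ k l) (B.sym y≈tᵏwˡ))
    , (λ (x , (k , l , x≈gᵏhˡ) , fx≈y) →
        k , l , B.trans (B.sym fx≈y) (B.trans (⟦⟧-cong x≈gᵏhˡ) (f-gᵏhˡ k l)))
    where
    f-gᵏhˡ : ∀ k l → f (g NA.^ᶻ k A.∙ h NA.^ᶻ l) B.≈ t NB.^ᶻ k B.∙ w NB.^ᶻ l
    f-gᵏhˡ k l = begin
      f (g NA.^ᶻ k A.∙ h NA.^ᶻ l)       ≈⟨ homo _ _ ⟩
      f (g NA.^ᶻ k) B.∙ f (h NA.^ᶻ l)   ≈⟨ B.∙-cong (homo-^ᶻ g k) (homo-^ᶻ h l) ⟩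
      f g NB.^ᶻ k B.∙ f h NB.^ᶻ l       ≈⟨ B.∙-cong (^ᶻ-congˡ k fg≈t) (^ᶻ-congˡ l fh≈w) ⟩
      t NB.^ᶻ k B.∙ w NB.^ᶻ l           ∎

module ZnPowProperties (n s : ℕ) where
  open AbelianGroup (ℤ/ n ℤ^ s) hiding (group)
  open GroupNotions (group (ℤ/ n ℤ^ s))
    using (_^ᶻ_; powℕ; NormalClosure; NormallyGenerates; ≈-resp)
  open FiniteProducts (ℤ/ n ℤ^ s) using (sum)
  open NormalClosureProperties (group (ℤ/ n ℤ^ s)) using (NormalClosure-sum)
  private
    module ℤΣ = FiniteProducts ℤ.+-0-abelianGroup

  δ : Fin s → Carrier
  δ i j with i Fin.≟ j
  ... | yes _ = + 1
  ... | no  _ = + 0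

  δ-diag : ∀ i → δ i i ≡ + 1
  δ-diag i with i Fin.≟ i
  ... | yes _   = ≡.refl
  ... | no  i≢i = contradiction ≡.refl i≢i

  δ-off : ∀ {i j} → i ≢ j → δ i j ≡ + 0
  δ-off {i} {j} i≢j with i Fin.≟ j
  ... | yes i≡j = contradiction i≡j i≢j
  ... | no  _   = ≡.refl

  ^ᶻ-pointwise : ∀ g k j → (g ^ᶻ k) j ≡ k ℤ.* g j
  ^ᶻ-pointwise g (+ m)    j = powℕ-pointwise m
    where
    powℕ-pointwise : ∀ m → powℕ g m j ≡ + m ℤ.* g j
    powℕ-pointwise zero    = ≡.sym (ℤ.*-zeroˡ (g j))
    powℕ-pointwise (suc m) =
      ≡.trans (≡.cong (λ a → g j ℤ.+ a) (powℕ-pointwise m)) (≡.sym (ℤ.suc-* (+ m) (g j)))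
  ^ᶻ-pointwise g -[1+ m ] j =
    ≡.trans (≡.cong ℤ.-_ (^ᶻ-pointwise g (+ suc m) j)) (ℤ.neg-distribˡ-* (+ suc m) (g j))

  sum-pointwise : ∀ {k} (f : Vector Carrier k) j → sum f j ≡ ℤΣ.sum (λ i → f i j)
  sum-pointwise {zero}  f j = ≡.refl
  sum-pointwise {suc k} f j = ≡.cong (λ a → f Fin.zero j ℤ.+ a) (sum-pointwise (tail f) j)

  δ-expansion : ∀ x → sum (λ i → δ i ^ᶻ x i) ≈ x
  δ-expansion x = ZnPow.≡⇒≈ n s λ j → begin
    sum (λ i → δ i ^ᶻ x i) j        ≡⟨ sum-pointwise (λ i → δ i ^ᶻ x i) j ⟩
    ℤΣ.sum (λ i → (δ i ^ᶻ x i) j)   ≡⟨ ℤΣ.sum-cong-≋ (λ i → ^ᶻ-pointwise (δ i) (x i) j) ⟩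
    ℤΣ.sum (λ i → x i ℤ.* δ i j)    ≡⟨ ℤΣ.sum-single _ j (λ i i≢j → xᵢδᵢⱼ≡0 i≢j) ⟩
    x j ℤ.* δ j j                   ≡⟨ ≡.cong (x j ℤ.*_) (δ-diag j) ⟩
    x j ℤ.* + 1                     ≡⟨ ℤ.*-identityʳ (x j) ⟩
    x j                             ∎
    where
    open ≡.≡-Reasoning
    xᵢδᵢⱼ≡0 : ∀ {i j} → i ≢ j → x i ℤ.* δ i j ≡ + 0
    xᵢδᵢⱼ≡0 {i} i≢j = ≡.trans (≡.cong (x i ℤ.*_) (δ-off i≢j)) (ℤ.*-zeroʳ (x i))

  normallyGenerated-δ : ∀ {p} {P : Carrier → Set p} →
                        (∀ i k → NormalClosure P (δ i ^ᶻ k)) → NormallyGenerates P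
  normallyGenerated-δ δᵏ∈⟪P⟫ x =
    ≈-resp (δ-expansion x) (NormalClosure-sum _ (λ i → δᵏ∈⟪P⟫ i (x i)))

module PowerProduct {c ℓ} (A : AbelianGroup c ℓ) {n s : ℕ} (t : Fin s → AbelianGroup.Carrier A)
         (tⁿ≈ε : ∀ j → AbelianGroup._≈_ A (GroupNotions.powℕ (group A) (t j) n) (AbelianGroup.ε A))
         where
  open AbelianGroup A hiding (group)
  open GroupNotions (group A) using (_^ᶻ_)
  open Powers A using (^ᶻ-cong-mod; ^ᶻ-homo-+; ^ᶻ-neg)
  open FiniteProducts A using (sum; sum-cong-≋; ∑-distrib-+; sum-⁻¹; sum-single; sum-replicate-zero)
  open ZnPowProperties n s using (δ; δ-diag; δ-off)
  open import Relation.Binary.Reasoning.Setoid setoid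

  π : AbelianGroup.Carrier (ℤ/ n ℤ^ s) → Carrier
  π x = sum (λ j → t j ^ᶻ x j)

  π-isGroupHomomorphism :
    IsGroupHomomorphism (Group.rawGroup (group (ℤ/ n ℤ^ s))) (Group.rawGroup (group A)) π
  π-isGroupHomomorphism = record
    { isMonoidHomomorphism = record
      { isMagmaHomomorphism = record
        { isRelHomomorphism = record
          { cong = λ {x} {y} x≈y → sum-cong-≋ (λ j → ^ᶻ-cong-mod n (tⁿ≈ε j) {x j} {y j} (x≈y j)) }
        ; homo = λ x y → trans (sum-cong-≋ (λ j → ^ᶻ-homo-+ (t j) (x j) (y j)))
                               (∑-distrib-+ (λ j → t j ^ᶻ x j) (λ j → t j ^ᶻ y j))
        }
      ; ε-homo = sum-replicate-zero s
      }
    ; ⁻¹-homo = λ x → trans (sum-cong-≋ (λ j → ^ᶻ-neg (t j) (x j))) (sum-⁻¹ (λ j → t j ^ᶻ x j))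
    }

  π-δ : ∀ i → π (δ i) ≈ t i
  π-δ i = begin
    sum (λ j → t j ^ᶻ δ i j)  ≈⟨ sum-single _ i (λ j j≢i → tⱼ^δᵢⱼ≈ε (j≢i ∘ ≡.sym)) ⟩
    t i ^ᶻ δ i i              ≡⟨ ≡.cong (t i ^ᶻ_) (δ-diag i) ⟩
    t i ∙ ε                   ≈⟨ identityʳ (t i) ⟩
    t i                       ∎
    where
    tⱼ^δᵢⱼ≈ε : ∀ {j} → i ≢ j → t j ^ᶻ δ i j ≈ ε
    tⱼ^δᵢⱼ≈ε {j} i≢j = reflexive (≡.cong (t j ^ᶻ_) (δ-off i≢j))

TameRamConfig⇒TameDecConfig : ∀ {c ℓ p s} (H : AbelianGroup c ℓ) →
                              TameRamConfig (group H) p s → TameDecConfig (group H) p s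
TameRamConfig⇒TameDecConfig H CH = record
  { ram        = CH
  ; Z          = T
  ; T⊆Z        = λ i x∈T → x∈T
  ; T-normal   = λ i → IsNormalIn-abelian (T i) (T i)
  ; Z/T-cyclic = λ i → QuotientCyclic-refl (T i)
  }
  where
  open TameRamConfig CH using (T)
  open PowerSubgroups H using (IsNormalIn-abelian; QuotientCyclic-refl)

module Construction {c ℓ p} (H : AbelianGroup c ℓ) {s : ℕ} (fin : IsFinite (group H))
                    (CH : TameDecConfig (group H) p s) where
  private
    module H = AbelianGroup H
  open TameDecConfig CH
  open GroupNotions (group H) using (_⊆_; mem)
  open Powers H using (powℕ-factorial≈ε)
  open PowerSubgroups H using (⟨⟩⟨⟩⊆QuotientCyclic; QuotientCyclic⊆⟨⟩⟨⟩)
    renaming (⟨_⟩ to ⟨_⟩ᴴ; ⟨_⟩⟨_⟩ to ⟨_⟩⟨_⟩ᴴ)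

  n : ℕ
  n = proj₁ fin !

  n-nonZero : NonZero n
  n-nonZero = proj₁ fin ℕ.!≢0

  G : AbelianGroup 0ℓ 0ℓ
  G = ℤ/ n ℤ^ s
  private
    module G = AbelianGroup G
    module NG = GroupNotions (group G)
  open ZnPowProperties n s using (δ; normallyGenerated-δ)
  open PowerSubgroups G
    using (⟨_⟩; ⟨_⟩⟨_⟩; ⟨⟩-isCyclic; ⟨⟩⊆⟨⟩⟨⟩; ⟨⟩⟨⟩/⟨⟩-cyclic; IsNormalIn-abelian)
  open NormalClosureProperties (group G) using (NormalClosure-base; NormalClosure-^ᶻ)

  t w : Fin s → H.Carrier
  t i = proj₁ (T-cyclic i)
  w i = proj₁ (Z/T-cyclic i)

  T⊆⟨t⟩ : ∀ i → T i ⊆ ⟨ t i ⟩ᴴ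
  T⊆⟨t⟩ i {x} = proj₁ (proj₂ (T-cyclic i) x)

  ⟨t⟩⊆T : ∀ i → ⟨ t i ⟩ᴴ ⊆ T i
  ⟨t⟩⊆T i {x} = proj₂ (proj₂ (T-cyclic i) x)

  open PowerProduct H {n} t (λ j → powℕ-factorial≈ε fin (t j))
    using (π; π-isGroupHomomorphism; π-δ)
  open HomomorphismProperties (group G) (group H) π-isGroupHomomorphism using (HasRank-surjection)
  open AbelianImage (group G) H π-isGroupHomomorphism using (NormalClosure⊆image)
  open PowerSubgroupImages G H π-isGroupHomomorphism using (ImageEq-resp; ImageEq-⟨⟩; ImageEq-⟨⟩⟨⟩)

  T↦S : ∀ i → ImageEq (group G) (group H) π ⟨ δ i ⟩ (T i)
  T↦S i = ImageEq-resp ⟨ δ i ⟩ ⟨ t i ⟩ᴴ (T i) (⟨t⟩⊆T i) (T⊆⟨t⟩ i) (ImageEq-⟨⟩ (δ i) (π-δ i))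

  π-onto : ∀ y → ∃[ x ] (π x H.≈ y)
  π-onto y = NormalClosure⊆image T⊆image (T-gen y)
    where
    T⊆image : ∀ {y} → ∃[ i ] mem (T i) y → ∃[ x ] (π x H.≈ y)
    T⊆image {y} (i , y∈Tᵢ) = let (x , _ , πx≈y) = proj₁ (T↦S i y) y∈Tᵢ in x , πx≈y

  u : Fin s → G.Carrier
  u i = proj₁ (π-onto (w i))

  Z↦W : ∀ i → ImageEq (group G) (group H) π ⟨ δ i ⟩⟨ u i ⟩ (Z i)
  Z↦W i = ImageEq-resp ⟨ δ i ⟩⟨ u i ⟩ ⟨ t i ⟩⟨ w i ⟩ᴴ (Z i)
    (⟨⟩⟨⟩⊆QuotientCyclic (T i) (Z i) (t i) (⟨t⟩⊆T i) (T⊆Z i) (Z/T-cyclic i))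
    (QuotientCyclic⊆⟨⟩⟨⟩ (T i) (Z i) (t i) (T⊆⟨t⟩ i) (Z/T-cyclic i))
    (ImageEq-⟨⟩⟨⟩ (δ i) (u i) (π-δ i) (proj₂ (π-onto (w i))))

  CG : TameDecConfig (group G) 0ℓ s
  CG = record
    { ram = record
      { rank     = HasRank-surjection π-onto rank (δ , normallyGenerated-δ δᵏ∈⟪δ⟫)
      ; T        = λ i → ⟨ δ i ⟩
      ; T-cyclic = λ i → ⟨⟩-isCyclic (δ i)
      ; T-gen    = normallyGenerated-δ (λ i k → NormalClosure-base (i , k , G.refl {δ i NG.^ᶻ k}))
      }
    ; Z          = λ i → ⟨ δ i ⟩⟨ u i ⟩
    ; T⊆Z        = λ i {x} → ⟨⟩⊆⟨⟩⟨⟩ (δ i) (u i) {x}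
    ; T-normal   = λ i {z} {x} → IsNormalIn-abelian ⟨ δ i ⟩ ⟨ δ i ⟩⟨ u i ⟩ {z} {x}
    ; Z/T-cyclic = λ i → ⟨⟩⟨⟩/⟨⟩-cyclic (δ i) (u i)
    }
    where
    δᵏ∈⟪δ⟫ : ∀ i k → NG.NormalClosure (λ y → ∃[ j ] (y G.≈ δ j)) (δ i NG.^ᶻ k)
    δᵏ∈⟪δ⟫ i k = NormalClosure-^ᶻ k (NormalClosure-base (i , G.refl {δ i}))

  quotient : DecQuotient (group G) (group H) CG CH
  quotient = record
    { ramQuotient = record
      { epi = record { π = π ; isHom = π-isGroupHomomorphism ; surjective = π-onto }
      ; T↦S = T↦S
      }
    ; Z↦W = Z↦W
    }

proposition3p1 : ∀ {c ℓ p : Level} (H : AbelianGroup c ℓ) (s : ℕ) →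
  IsFinite (group H) →
  ((CH : TameDecConfig (group H) p s) →
    Σ ℕ λ n → NonZero n ×
      Σ (TameDecConfig (group (ℤ/ n ℤ^ s)) 0ℓ s) λ CG →
        DecQuotient (group (ℤ/ n ℤ^ s)) (group H) CG CH)
  ×
  ((CH : TameRamConfig (group H) p s) →
    Σ ℕ λ n → NonZero n ×
      Σ (TameRamConfig (group (ℤ/ n ℤ^ s)) 0ℓ s) λ CG →
        RamQuotient (group (ℤ/ n ℤ^ s)) (group H) CG CH)
proposition3p1 H s fin =
  (λ CH → let open Construction H fin CH in
     n , n-nonZero , CG , quotient) ,
  (λ CH → let open Construction H fin (TameRamConfig⇒TameDecConfig H CH) in
     n , n-nonZero , TameDecConfig.ram CG , DecQuotient.ramQuotient quotient)
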